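{- Let $k \in \mathbb{N}$, $k\ge 1$, let $C_1,\dots,C_k \in \mathbb{Z}$ and $x \in \mathbb{Z}$. Define $$P_k(n;x) = \sum_{j=1}^{k} C_j\,\bigl[\,n^j x^j + U_j(x)\,\bigr], \qquad Q_k(x) = \sum_{j=1}^{k} C_j\, V_j(x),$$ where the polynomials $U_j, V_j$ are as defined in the context. Then for every prime $p$ the series $\sum_{n=0}^{\infty} n!\,P_k(n;x)\,x^n$ converges in $\mathbb{Q}_p$ and $$\sum_{n=0}^{\infty} n!\,P_k(n;x)\,x^n = Q_k(x);$$ in particular the sum is the same integer for all primes $p$.
   Context: $n! = 1\cdot 2\cdots n$ with $0!=1$; $\mathbb{Q}_p$ is the field of $p$-adic numbers. The polynomials $U_j(x), V_j(x) \in \mathbb{Z}[x]$ ($j \ge 1$) are defined recursively by $U_1(x) = x-1$, $V_1(x) = -1$ and, for $k \ge 1$, $$U_{k+1}(x) = x^{k+1} + U_k(x) - \sum_{\ell=1}^{k}\binom{k+1}{\ell} x^{k+1-\ell}\,U_\ell(x), \qquad V_{k+1}(x) = V_k(x) - \sum_{\ell=1}^{k}\binom{k+1}{\ell} x^{k+1-\ell}\,V_\ell(x).$$ (E.g. $U_2(x) = -x^2+3x-1$, $V_2(x) = 2x-1$, $U_3(x) = x^3-7x^2+6x-1$, $V_3(x) = -3x^2+5x-1$.) Equivalently, $U_j(x) = x A_{j-1}(1;x) - A_{j-1}(0;x)$ and $V_j(x) = -A_{j-1}(0;x)$ where $A_{j-1}(n;x)$ is a polynomial in $x$ with coefficients polynomial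 in $n$ satisfying $\sum_{n=0}^{N-1} n!\,[n^j x^j + U_j(x)]x^n = V_j(x) + N!\,x^N A_{j-1}(N;x)$ for all $N\in\mathbb{N}$. -}

module Defs where

open import Data.Nat as ℕ using (ℕ; zero; suc; _!; _≡ᵇ_)
open import Data.Nat.Combinatorics using (_C_)
open import Data.Integer using (ℤ; +_; _+_; _-_; _*_; _^_; 0ℤ; 1ℤ; -1ℤ)
open import Data.Bool using (if_then_else_)

sum1 : ℕ → (ℕ → ℤ) → ℤ
sum1 zero    f = 0ℤ
sum1 (suc k) f = sum1 k f + f (suc k)

sum0 : ℕ → (ℕ → ℤ) → ℤ
sum0 zero    f = 0ℤ
sum0 (suc N) f = sum0 N f + f N

-- Table of values of U_j at x: UTab x k ℓ = U_ℓ(x) for 1 ≤ ℓ ≤ k+1.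
-- U_{k+1}(x) = x^{k+1} + U_k(x) - Σ_{ℓ=1}^{k} C(k+1,ℓ) x^{k+1-ℓ} U_ℓ(x)
UTab : ℤ → ℕ → ℕ → ℤ
UTab x zero = λ _ → x - 1ℤ
UTab x (suc k) =
  let g   = UTab x k
      new = (x ^ (suc (suc k))) + g (suc k)
              - sum1 (suc k) (λ ℓ → (+ ((suc (suc k)) C ℓ)) * (x ^ ((suc (suc k)) ℕ.∸ ℓ)) * g ℓ)
  in λ ℓ → if ℓ ≡ᵇ suc (suc k) then new else g ℓ

U : ℕ → ℤ → ℤ
U j x = UTab x (j ℕ.∸ 1) j

-- V_1(x) = -1,  V_{k+1}(x) = V_k(x) - Σ_{ℓ=1}^{k} C(k+1,ℓ) x^{k+1-ℓ} V_ℓ(x)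
VTab : ℤ → ℕ → ℕ → ℤ
VTab x zero = λ _ → -1ℤ
VTab x (suc k) =
  let g   = VTab x k
      new = g (suc k)
              - sum1 (suc k) (λ ℓ → (+ ((suc (suc k)) C ℓ)) * (x ^ ((suc (suc k)) ℕ.∸ ℓ)) * g ℓ)
  in λ ℓ → if ℓ ≡ᵇ suc (suc k) then new else g ℓ

V : ℕ → ℤ → ℤ
V j x = VTab x (j ℕ.∸ 1) j

P : ℕ → (ℕ → ℤ) → ℕ → ℤ → ℤ
P k c n x = sum1 k (λ j → c j * ((+ n) ^ j * x ^ j + U j x))

Q : ℕ → (ℕ → ℤ) → ℤ → ℤ
Q k c x = sum1 k (λ j → c j * V j x)

S : ℕ → (ℕ → ℤ) → ℤ → ℕ → ℤ
S k c x N = sum0 N (λ n → (+ (n !)) * P k c n x * x ^ n)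

-- Write  (Δ A)(n) = (n+1)·x·A(n+1) − A(n)  for a sequence A.  Then
-- n!·(Δ A)(n)·x^n = (n+1)!x^{n+1}A(n+1) − n!x^nA(n), so the partial sums
-- telescope:  Σ_{n<N} n!(Δ A)(n)x^n = N!x^N A(N) − A(0).
-- The heart of the proof is the construction, for every j ≥ 1, of a
-- "primitive" A_j (the values of A_{j-1}(n;x) of the paper) with
--   (Δ A_j)(n) = n^j x^j + U_j(x)   and   A_j(0) = −V_j(x).
-- A_1 = 1, and A_{m+1} = x^m n^m + A_m − Σ_{ℓ=1}^{m} C(m+1,ℓ)x^{m+1−ℓ}A_ℓ,
-- which works because Δ(x^m n^m) is computed by the binomial theorem and the
-- correction terms reproduce exactly the recursions defining U_{m+1}, V_{m+1}.
-- Taking G = Σ_j C_j A_j gives  S_N − Q_k(x) = N!·x^N·G(N), which is divisible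
-- by any d ≥ 1 once N ≥ d; for d = p^m this is p-adic convergence to Q_k(x).

module Submission where

open import Defs
open import Data.Nat using (ℕ; _≤_; _^_)
open import Data.Nat.Primality using (Prime)
open import Data.Integer using (ℤ; +_; _-_)
open import Data.Integer.Divisibility using (_∣_)
open import Data.Product using (Σ)

open import Data.Nat using (zero; suc; _<_; _∸_; _!; _≡ᵇ_; z≤n; s≤s)
import Data.Nat.Properties as ℕP
import Data.Nat.Divisibility as ℕD
open import Data.Nat.Primality using (prime⇒nonZero)
open import Data.Nat.Combinatorics using (_C_; nCk+nC[k+1]≡[n+1]C[k+1]; nCn≡1)
open import Data.Nat.Combinatorics.Specification using (k>n⇒nCk≡0)
open import Data.Integer using (_+_; _*_; -_; 0ℤ; 1ℤ; ∣_∣) renaming (_^_ to _^ᶻ_)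
import Data.Integer.Properties as ℤP
open import Data.Integer.Tactic.RingSolver using (solve-∀)
open import Data.Product using (_,_; proj₁; proj₂; _×_)
open import Data.Sum using (inj₁; inj₂)
open import Data.Bool using (true; false; if_then_else_)
open import Relation.Binary.PropositionalEquality
open ≡-Reasoning

sum1-cong : ∀ n {f g : ℕ → ℤ} → (∀ ℓ → 1 ≤ ℓ → ℓ ≤ n → f ℓ ≡ g ℓ) → sum1 n f ≡ sum1 n g
sum1-cong zero    f≡g = refl
sum1-cong (suc n) f≡g =
  cong₂ _+_ (sum1-cong n (λ ℓ 1≤ℓ ℓ≤n → f≡g ℓ 1≤ℓ (ℕP.m≤n⇒m≤1+n ℓ≤n)))
            (f≡g (suc n) (s≤s z≤n) ℕP.≤-refl)

sum1-+ : ∀ n (f g : ℕ → ℤ) → sum1 n (λ ℓ → f ℓ + g ℓ) ≡ sum1 n f + sum1 n g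
sum1-+ zero    f g = refl
sum1-+ (suc n) f g = trans (cong (_+ (f (suc n) + g (suc n))) (sum1-+ n f g))
                           (interchange (sum1 n f) (sum1 n g) (f (suc n)) (g (suc n)))
  where interchange : ∀ a b c d → (a + b) + (c + d) ≡ (a + c) + (b + d)
        interchange = solve-∀

sum1-* : ∀ n (a : ℤ) (f : ℕ → ℤ) → a * sum1 n f ≡ sum1 n (λ ℓ → a * f ℓ)
sum1-* zero    a f = ℤP.*-zeroʳ a
sum1-* (suc n) a f = trans (ℤP.*-distribˡ-+ a (sum1 n f) (f (suc n)))
                           (cong (_+ a * f (suc n)) (sum1-* n a f))

sum1-neg : ∀ n (f : ℕ → ℤ) → sum1 n (λ ℓ → - f ℓ) ≡ - sum1 n f
sum1-neg zero    f = refl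
sum1-neg (suc n) f = trans (cong (_+ - f (suc n)) (sum1-neg n f))
                           (sym (ℤP.neg-distrib-+ (sum1 n f) (f (suc n))))

sum1-peel : ∀ n (f : ℕ → ℤ) → sum1 (suc n) f ≡ f 1 + sum1 n (λ ℓ → f (suc ℓ))
sum1-peel zero    f = trans (ℤP.+-identityˡ (f 1)) (sym (ℤP.+-identityʳ (f 1)))
sum1-peel (suc n) f = trans (cong (_+ f (suc (suc n))) (sum1-peel n f))
                            (ℤP.+-assoc (f 1) _ _)

binomial : ∀ n (y : ℤ) → (1ℤ + y) ^ᶻ n ≡ 1ℤ + sum1 n (λ ℓ → + (n C ℓ) * y ^ᶻ ℓ)
binomial zero    y = refl
binomial (suc n) y = begin
    (1ℤ + y) * (1ℤ + y) ^ᶻ n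
  ≡⟨ cong ((1ℤ + y) *_) (binomial n y) ⟩
    (1ℤ + y) * (1ℤ + T)
  ≡⟨ expand y T ⟩
    1ℤ + (y * (1ℤ + T) + (T + 0ℤ))
  ≡⟨ cong₂ (λ s t → 1ℤ + (y * s + (T + t))) (sym (sum1-peel n shifted)) (sym top-vanishes) ⟩
    1ℤ + (y * sum1 (suc n) shifted + sum1 (suc n) term)
  ≡⟨ cong (λ s → 1ℤ + (s + sum1 (suc n) term)) (sum1-* (suc n) y shifted) ⟩
    1ℤ + (sum1 (suc n) (λ ℓ → y * shifted ℓ) + sum1 (suc n) term)
  ≡⟨ cong (λ s → 1ℤ + s) (sym (sum1-+ (suc n) _ term)) ⟩
    1ℤ + sum1 (suc n) (λ ℓ → y * shifted ℓ + term ℓ)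
  ≡⟨ cong (λ s → 1ℤ + s) (sum1-cong (suc n) pascal) ⟩
    1ℤ + sum1 (suc n) (λ ℓ → + (suc n C ℓ) * y ^ᶻ ℓ)
  ∎
  where
  term shifted : ℕ → ℤ
  term ℓ = + (n C ℓ) * y ^ᶻ ℓ
  shifted ℓ = term (ℓ ∸ 1)
  T : ℤ
  T = sum1 n term
  expand : ∀ y T → (1ℤ + y) * (1ℤ + T) ≡ 1ℤ + (y * (1ℤ + T) + (T + 0ℤ))
  expand = solve-∀
  top-vanishes : term (suc n) ≡ 0ℤ
  top-vanishes rewrite k>n⇒nCk≡0 {n} {suc n} (ℕP.n<1+n n) = refl
  pascal : ∀ ℓ → 1 ≤ ℓ → ℓ ≤ suc n → y * shifted ℓ + term ℓ ≡ + (suc n C ℓ) * y ^ᶻ ℓ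
  pascal (suc ℓ) _ _ = begin
      y * (+ (n C ℓ) * y ^ᶻ ℓ) + + (n C suc ℓ) * (y * y ^ᶻ ℓ)
    ≡⟨ collect y (+ (n C ℓ)) (+ (n C suc ℓ)) (y ^ᶻ ℓ) ⟩
      (+ (n C ℓ) + + (n C suc ℓ)) * (y * y ^ᶻ ℓ)
    ≡⟨ cong (λ c → + c * (y * y ^ᶻ ℓ)) (nCk+nC[k+1]≡[n+1]C[k+1] n ℓ) ⟩
      + (suc n C suc ℓ) * (y * y ^ᶻ ℓ)
    ∎
    where collect : ∀ y a b z → y * (a * z) + b * (y * z) ≡ (a + b) * (y * z)
          collect = solve-∀

-- Tables.  Defs builds U and V through tables that, passing from stage k to
-- k+1, only overwrite the entry at index k+2; `update` names that step.

update : {A : Set} → (ℕ → A) → ℕ → A → ℕ → A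
update g j v ℓ = if ℓ ≡ᵇ j then v else g ℓ

≡ᵇ-refl : ∀ n → (n ≡ᵇ n) ≡ true
≡ᵇ-refl zero    = refl
≡ᵇ-refl (suc n) = ≡ᵇ-refl n

<⇒≡ᵇ-false : ∀ {m n} → m < n → (m ≡ᵇ n) ≡ false
<⇒≡ᵇ-false {zero}  {suc n} _         = refl
<⇒≡ᵇ-false {suc m} {suc n} (s≤s m<n) = <⇒≡ᵇ-false m<n

update-here : ∀ {A : Set} (g : ℕ → A) j v → update g j v j ≡ v
update-here g j v rewrite ≡ᵇ-refl j = refl

update-other : ∀ {A : Set} (g : ℕ → A) {j v ℓ} → ℓ < j → update g j v ℓ ≡ g ℓ
update-other g ℓ<j rewrite <⇒≡ᵇ-false ℓ<j = refl

table-entry : ∀ {A : Set} (T : ℕ → ℕ → A) →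
  (∀ k ℓ → ℓ ≤ suc k → T (suc k) ℓ ≡ T k ℓ) →
  ∀ k ℓ → 1 ≤ ℓ → ℓ ≤ suc k → T k ℓ ≡ T (ℓ ∸ 1) ℓ
table-entry T stable zero    (suc zero)    _ _          = refl
table-entry T stable zero    (suc (suc ℓ)) _ (s≤s ())
table-entry T stable (suc k) ℓ           1≤ℓ ℓ≤2+k with ℕP.m≤n⇒m<n∨m≡n ℓ≤2+k
... | inj₁ (s≤s ℓ≤1+k) = trans (stable k ℓ ℓ≤1+k) (table-entry T stable k ℓ 1≤ℓ ℓ≤1+k)
... | inj₂ refl        = refl

module Construction (x : ℤ) where

  coeff : ℕ → ℕ → ℤ
  coeff j ℓ = + (j C ℓ) * x ^ᶻ (j ∸ ℓ)

  UTab-entry : ∀ k ℓ → 1 ≤ ℓ → ℓ ≤ suc k → UTab x k ℓ ≡ U ℓ x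
  UTab-entry = table-entry (UTab x) (λ k ℓ ℓ≤1+k → update-other (UTab x k) (s≤s ℓ≤1+k))

  VTab-entry : ∀ k ℓ → 1 ≤ ℓ → ℓ ≤ suc k → VTab x k ℓ ≡ V ℓ x
  VTab-entry = table-entry (VTab x) (λ k ℓ ℓ≤1+k → update-other (VTab x k) (s≤s ℓ≤1+k))

  U-rec : ∀ k → U (suc (suc k)) x
        ≡ x ^ᶻ suc (suc k) + U (suc k) x - sum1 (suc k) (λ ℓ → coeff (suc (suc k)) ℓ * U ℓ x)
  U-rec k rewrite ≡ᵇ-refl k =
    cong (λ s → x ^ᶻ suc (suc k) + U (suc k) x - s)
         (sum1-cong (suc k) (λ ℓ 1≤ℓ ℓ≤1+k → cong (coeff (suc (suc k)) ℓ *_) (UTab-entry k ℓ 1≤ℓ ℓ≤1+k)))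

  V-rec : ∀ k → V (suc (suc k)) x
        ≡ V (suc k) x - sum1 (suc k) (λ ℓ → coeff (suc (suc k)) ℓ * V ℓ x)
  V-rec k rewrite ≡ᵇ-refl k =
    cong (λ s → V (suc k) x - s)
         (sum1-cong (suc k) (λ ℓ 1≤ℓ ℓ≤1+k → cong (coeff (suc (suc k)) ℓ *_) (VTab-entry k ℓ 1≤ℓ ℓ≤1+k)))

  Δ : (ℕ → ℤ) → ℕ → ℤ
  Δ A n = + suc n * x * A (suc n) - A n

  telescope : ∀ (A f : ℕ → ℤ) → (∀ n → Δ A n ≡ f n) →
    ∀ N → sum0 N (λ n → + (n !) * f n * x ^ᶻ n) ≡ + (N !) * x ^ᶻ N * A N - A 0
  telescope A f ΔA≡f zero    = empty (A 0)
    where empty : ∀ a → 0ℤ ≡ 1ℤ * 1ℤ * a - a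
          empty = solve-∀
  telescope A f ΔA≡f (suc N) = begin
      sum0 N (λ n → + (n !) * f n * x ^ᶻ n) + + (N !) * f N * x ^ᶻ N
    ≡⟨ cong₂ (λ s t → s + + (N !) * t * x ^ᶻ N) (telescope A f ΔA≡f N) (sym (ΔA≡f N)) ⟩
      (+ (N !) * x ^ᶻ N * A N - A 0) + + (N !) * (+ suc N * x * A (suc N) - A N) * x ^ᶻ N
    ≡⟨ cancel (+ (N !)) (x ^ᶻ N) (A N) (A (suc N)) (A 0) (+ suc N) x ⟩
      (+ suc N * + (N !)) * (x * x ^ᶻ N) * A (suc N) - A 0
    ≡⟨ cong (λ f → f * (x * x ^ᶻ N) * A (suc N) - A 0) (sym (ℤP.pos-* (suc N) (N !))) ⟩
      + (suc N !) * x ^ᶻ suc N * A (suc N) - A 0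
    ∎
    where cancel : ∀ f p a a' a₀ s x → (f * p * a - a₀) + f * (s * x * a' - a) * p
                                      ≡ (s * f) * (x * p) * a' - a₀
          cancel = solve-∀

  Δ-sum : ∀ m (c : ℕ → ℤ) (F : ℕ → ℕ → ℤ) n →
    Δ (λ n → sum1 m (λ ℓ → c ℓ * F ℓ n)) n ≡ sum1 m (λ ℓ → c ℓ * Δ (F ℓ) n)
  Δ-sum zero    c F n = vanish (+ suc n * x)
    where vanish : ∀ a → a * 0ℤ - 0ℤ ≡ 0ℤ
          vanish = solve-∀
  Δ-sum (suc m) c F n =
    trans (regroup (+ suc n * x) (sum1 m (λ ℓ → c ℓ * F ℓ (suc n))) (sum1 m (λ ℓ → c ℓ * F ℓ n))
                   (c (suc m)) (F (suc m) (suc n)) (F (suc m) n))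
          (cong (_+ c (suc m) * Δ (F (suc m)) n) (Δ-sum m c F n))
    where regroup : ∀ a s₁ s₀ c f₁ f₀ → a * (s₁ + c * f₁) - (s₀ + c * f₀)
                                      ≡ (a * s₁ - s₀) + c * (a * f₁ - f₀)
          regroup = solve-∀

  IsPrimitive : ℕ → (ℕ → ℤ) → Set
  IsPrimitive j A = (∀ n → Δ A n ≡ (+ n) ^ᶻ j * x ^ᶻ j + U j x) × (A 0 ≡ - V j x)

  primitive-one : IsPrimitive 1 (λ _ → 1ℤ)
  primitive-one = (λ n → difference (+ n) x) , refl
    where difference : ∀ n x → (1ℤ + n) * x * 1ℤ - 1ℤ ≡ (n * 1ℤ) * (x * 1ℤ) + (x - 1ℤ)
          difference = solve-∀

  -- B m n = Σ_{ℓ=1}^{m} C(m+1,ℓ) n^ℓ, the middle of the binomial expansion of (n+1)^{m+1}.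
  B : ℕ → ℕ → ℤ
  B m n = sum1 m (λ ℓ → + (suc m C ℓ) * (+ n) ^ᶻ ℓ)

  Δ-monomial : ∀ m n → Δ (λ n → x ^ᶻ m * (+ n) ^ᶻ m) n
             ≡ x ^ᶻ suc m * (1ℤ + B m n + (+ n) ^ᶻ suc m) - x ^ᶻ m * (+ n) ^ᶻ m
  Δ-monomial m n = cong (_- x ^ᶻ m * (+ n) ^ᶻ m) (begin
      (1ℤ + + n) * x * (x ^ᶻ m * (1ℤ + + n) ^ᶻ m)
    ≡⟨ reorder (1ℤ + + n) x (x ^ᶻ m) ((1ℤ + + n) ^ᶻ m) ⟩
      x ^ᶻ suc m * (1ℤ + + n) ^ᶻ suc m
    ≡⟨ cong (x ^ᶻ suc m *_) (binomial (suc m) (+ n)) ⟩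
      x ^ᶻ suc m * (1ℤ + (B m n + + (suc m C suc m) * (+ n) ^ᶻ suc m))
    ≡⟨ cong (λ c → x ^ᶻ suc m * (1ℤ + (B m n + + c * (+ n) ^ᶻ suc m))) (nCn≡1 (suc m)) ⟩
      x ^ᶻ suc m * (1ℤ + (B m n + 1ℤ * (+ n) ^ᶻ suc m))
    ≡⟨ cong (x ^ᶻ suc m *_) (tidy (B m n) ((+ n) ^ᶻ suc m)) ⟩
      x ^ᶻ suc m * (1ℤ + B m n + (+ n) ^ᶻ suc m)
    ∎)
    where reorder : ∀ s x p q → s * x * (p * q) ≡ (x * p) * (s * q)
          reorder = solve-∀
          tidy : ∀ b q → 1ℤ + (b + 1ℤ * q) ≡ 1ℤ + b + q
          tidy = solve-∀

  Δ-correction : ∀ m (F : ℕ → ℕ → ℤ) → (∀ ℓ → 1 ≤ ℓ → ℓ ≤ m → IsPrimitive ℓ (F ℓ)) → ∀ n →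
    Δ (λ n → sum1 m (λ ℓ → coeff (suc m) ℓ * F ℓ n)) n
    ≡ x ^ᶻ suc m * B m n + sum1 m (λ ℓ → coeff (suc m) ℓ * U ℓ x)
  Δ-correction m F prim n = begin
      Δ (λ n → sum1 m (λ ℓ → coeff (suc m) ℓ * F ℓ n)) n
    ≡⟨ Δ-sum m (coeff (suc m)) F n ⟩
      sum1 m (λ ℓ → coeff (suc m) ℓ * Δ (F ℓ) n)
    ≡⟨ sum1-cong m termwise ⟩
      sum1 m (λ ℓ → x ^ᶻ suc m * (+ (suc m C ℓ) * (+ n) ^ᶻ ℓ) + coeff (suc m) ℓ * U ℓ x)
    ≡⟨ sum1-+ m _ _ ⟩
      sum1 m (λ ℓ → x ^ᶻ suc m * (+ (suc m C ℓ) * (+ n) ^ᶻ ℓ)) + sum1 m (λ ℓ → coeff (suc m) ℓ * U ℓ x)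
    ≡⟨ cong (_+ sum1 m (λ ℓ → coeff (suc m) ℓ * U ℓ x)) (sym (sum1-* m (x ^ᶻ suc m) _)) ⟩
      x ^ᶻ suc m * B m n + sum1 m (λ ℓ → coeff (suc m) ℓ * U ℓ x)
    ∎
    where
    distribute : ∀ c e p q u → c * e * (p * q + u) ≡ (e * q) * (c * p) + c * e * u
    distribute = solve-∀
    powers : ∀ ℓ → ℓ ≤ m → x ^ᶻ (suc m ∸ ℓ) * x ^ᶻ ℓ ≡ x ^ᶻ suc m
    powers ℓ ℓ≤m = trans (sym (ℤP.^-distribˡ-+-* x (suc m ∸ ℓ) ℓ))
                         (cong (x ^ᶻ_) (ℕP.m∸n+n≡m (ℕP.m≤n⇒m≤1+n ℓ≤m)))
    termwise : ∀ ℓ → 1 ≤ ℓ → ℓ ≤ m → coeff (suc m) ℓ * Δ (F ℓ) n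
             ≡ x ^ᶻ suc m * (+ (suc m C ℓ) * (+ n) ^ᶻ ℓ) + coeff (suc m) ℓ * U ℓ x
    termwise ℓ 1≤ℓ ℓ≤m = begin
        coeff (suc m) ℓ * Δ (F ℓ) n
      ≡⟨ cong (coeff (suc m) ℓ *_) (proj₁ (prim ℓ 1≤ℓ ℓ≤m) n) ⟩
        coeff (suc m) ℓ * ((+ n) ^ᶻ ℓ * x ^ᶻ ℓ + U ℓ x)
      ≡⟨ distribute (+ (suc m C ℓ)) (x ^ᶻ (suc m ∸ ℓ)) ((+ n) ^ᶻ ℓ) (x ^ᶻ ℓ) (U ℓ x) ⟩
        (x ^ᶻ (suc m ∸ ℓ) * x ^ᶻ ℓ) * (+ (suc m C ℓ) * (+ n) ^ᶻ ℓ) + coeff (suc m) ℓ * U ℓ x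
      ≡⟨ cong (λ e → e * (+ (suc m C ℓ) * (+ n) ^ᶻ ℓ) + coeff (suc m) ℓ * U ℓ x) (powers ℓ ℓ≤m) ⟩
        x ^ᶻ suc m * (+ (suc m C ℓ) * (+ n) ^ᶻ ℓ) + coeff (suc m) ℓ * U ℓ x
      ∎

  next : ℕ → (ℕ → ℕ → ℤ) → ℕ → ℤ
  next k F n = x ^ᶻ suc k * (+ n) ^ᶻ suc k + F (suc k) n
             - sum1 (suc k) (λ ℓ → coeff (suc (suc k)) ℓ * F ℓ n)

  next-primitive : ∀ k (F : ℕ → ℕ → ℤ) → (∀ ℓ → 1 ≤ ℓ → ℓ ≤ suc k → IsPrimitive ℓ (F ℓ)) →
    IsPrimitive (suc (suc k)) (next k F)
  next-primitive k F prim = difference , initial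
    where
    m : ℕ
    m = suc k
    Um Tm Vm Wm : ℤ
    Um = U m x
    Tm = sum1 m (λ ℓ → coeff (suc m) ℓ * U ℓ x)
    Vm = V m x
    Wm = sum1 m (λ ℓ → coeff (suc m) ℓ * V ℓ x)
    primᵐ : IsPrimitive m (F m)
    primᵐ = prim m (s≤s z≤n) ℕP.≤-refl
    difference : ∀ n → Δ (next k F) n ≡ (+ n) ^ᶻ suc m * x ^ᶻ suc m + U (suc m) x
    difference n = begin
        Δ (next k F) n
      ≡⟨ split (+ suc n * x) (x ^ᶻ m * (+ suc n) ^ᶻ m) (F m (suc n)) (s (suc n))
                             (x ^ᶻ m * (+ n) ^ᶻ m) (F m n) (s n) ⟩
        Δ (λ n → x ^ᶻ m * (+ n) ^ᶻ m) n + Δ (F m) n - Δ s n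
      ≡⟨ cong₃ (λ a b c → a + b - c) (Δ-monomial m n) (proj₁ primᵐ n) (Δ-correction m F prim n) ⟩
        (X * (1ℤ + B m n + N) - x ^ᶻ m * (+ n) ^ᶻ m) + ((+ n) ^ᶻ m * x ^ᶻ m + Um) - (X * B m n + Tm)
      ≡⟨ collapse X (B m n) N (x ^ᶻ m) ((+ n) ^ᶻ m) Um Tm ⟩
        N * X + (X + Um - Tm)
      ≡⟨ cong (λ u → N * X + u) (sym (U-rec k)) ⟩
        N * X + U (suc m) x
      ∎
      where
      s : ℕ → ℤ
      s n = sum1 m (λ ℓ → coeff (suc m) ℓ * F ℓ n)
      X N : ℤ
      X = x ^ᶻ suc m
      N = (+ n) ^ᶻ suc m
      cong₃ : ∀ {a b c a' b' c' : ℤ} (f : ℤ → ℤ → ℤ → ℤ) → a ≡ a' → b ≡ b' → c ≡ c' → f a b c ≡ f a' b' c'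
      cong₃ f refl refl refl = refl
      split : ∀ a p₁ f₁ s₁ p₀ f₀ s₀ → a * (p₁ + f₁ - s₁) - (p₀ + f₀ - s₀)
                                    ≡ (a * p₁ - p₀) + (a * f₁ - f₀) - (a * s₁ - s₀)
      split = solve-∀
      collapse : ∀ X b N p q u t → (X * (1ℤ + b + N) - p * q) + (q * p + u) - (X * b + t)
                                 ≡ N * X + (X + u - t)
      collapse = solve-∀
    initial : next k F 0 ≡ - V (suc m) x
    initial = begin
        next k F 0
      ≡⟨ cong₂ (λ a w → x ^ᶻ m * (+ 0) ^ᶻ m + a - w) (proj₂ primᵐ) (sum1-cong m negate) ⟩
        x ^ᶻ m * (0ℤ * (+ 0) ^ᶻ k) + - Vm - sum1 m (λ ℓ → - (coeff (suc m) ℓ * V ℓ x))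
      ≡⟨ cong (λ w → x ^ᶻ m * (0ℤ * (+ 0) ^ᶻ k) + - Vm - w) (sum1-neg m _) ⟩
        x ^ᶻ m * (0ℤ * (+ 0) ^ᶻ k) + - Vm - - Wm
      ≡⟨ collapse (x ^ᶻ m) ((+ 0) ^ᶻ k) Vm Wm ⟩
        - (Vm - Wm)
      ≡⟨ cong -_ (sym (V-rec k)) ⟩
        - V (suc m) x
      ∎
      where
      negate : ∀ ℓ → 1 ≤ ℓ → ℓ ≤ m → coeff (suc m) ℓ * F ℓ 0 ≡ - (coeff (suc m) ℓ * V ℓ x)
      negate ℓ 1≤ℓ ℓ≤m = trans (cong (coeff (suc m) ℓ *_) (proj₂ (prim ℓ 1≤ℓ ℓ≤m)))
                               (sym (ℤP.neg-distribʳ-* (coeff (suc m) ℓ) (V ℓ x)))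
      collapse : ∀ p q v w → p * (0ℤ * q) + - v - - w ≡ - (v - w)
      collapse = solve-∀

  ATab : ℕ → ℕ → ℕ → ℤ
  ATab zero    = λ _ _ → 1ℤ
  ATab (suc k) = update (ATab k) (suc (suc k)) (next k (ATab k))

  ATab-primitive : ∀ k ℓ → 1 ≤ ℓ → ℓ ≤ suc k → IsPrimitive ℓ (ATab k ℓ)
  ATab-primitive zero    (suc zero)    _ _        = primitive-one
  ATab-primitive zero    (suc (suc ℓ)) _ (s≤s ())
  ATab-primitive (suc k) ℓ           1≤ℓ ℓ≤2+k with ℕP.m≤n⇒m<n∨m≡n ℓ≤2+k
  ... | inj₁ (s≤s ℓ≤1+k) =
    subst (IsPrimitive ℓ) (sym (update-other (ATab k) (s≤s ℓ≤1+k))) (ATab-primitive k ℓ 1≤ℓ ℓ≤1+k)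
  ... | inj₂ refl =
    subst (IsPrimitive ℓ) (sym (update-here (ATab k) ℓ _)) (next-primitive k (ATab k) (ATab-primitive k))

  partial-sum : ∀ k (c : ℕ → ℤ) N →
    S (suc k) c x N - Q (suc k) c x ≡ + (N !) * (x ^ᶻ N * sum1 (suc k) (λ j → c j * ATab k j N))
  partial-sum k c N = begin
      S (suc k) c x N - Q (suc k) c x
    ≡⟨ cong (_- Q (suc k) c x) (telescope G (λ n → P (suc k) c n x) ΔG N) ⟩
      + (N !) * x ^ᶻ N * G N - G 0 - Q (suc k) c x
    ≡⟨ cong (λ g → + (N !) * x ^ᶻ N * G N - g - Q (suc k) c x) G0 ⟩
      + (N !) * x ^ᶻ N * G N - - Q (suc k) c x - Q (suc k) c x
    ≡⟨ cancel (+ (N !)) (x ^ᶻ N) (G N) (Q (suc k) c x) ⟩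
      + (N !) * (x ^ᶻ N * G N)
    ∎
    where
    G : ℕ → ℤ
    G n = sum1 (suc k) (λ j → c j * ATab k j n)
    ΔG : ∀ n → Δ G n ≡ P (suc k) c n x
    ΔG n = trans (Δ-sum (suc k) c (ATab k) n)
                 (sum1-cong (suc k) (λ j 1≤j j≤1+k → cong (c j *_) (proj₁ (ATab-primitive k j 1≤j j≤1+k) n)))
    G0 : G 0 ≡ - Q (suc k) c x
    G0 = trans (sum1-cong (suc k) (λ j 1≤j j≤1+k →
                  trans (cong (c j *_) (proj₂ (ATab-primitive k j 1≤j j≤1+k)))
                        (sym (ℤP.neg-distribʳ-* (c j) (V j x)))))
               (sum1-neg (suc k) _)
    cancel : ∀ f p g q → f * p * g - - q - q ≡ f * (p * g)
    cancel = solve-∀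

open Construction using (partial-sum)

∣-factorial : ∀ {d N} → 1 ≤ d → d ≤ N → d ℕD.∣ (N !)
∣-factorial {suc a} _ d≤N = ℕD.∣-trans (ℕD.m∣m*n (a !)) (ℕD.m≤n⇒m!∣n! d≤N)

eventually-divisible : ∀ k (c : ℕ → ℤ) x {d} → 1 ≤ d → ∀ N → d ≤ N →
  (+ d) ∣ (S (suc k) c x N - Q (suc k) c x)
eventually-divisible k c x 1≤d N d≤N =
  subst ((+ _) ∣_) (sym (partial-sum x k c N))
    (subst (_ ℕD.∣_) (sym (ℤP.abs-* (+ (N !)) z)) (ℕD.∣m⇒∣m*n ∣ z ∣ (∣-factorial 1≤d d≤N)))
  where z : ℤ
        z = x ^ᶻ N * sum1 (suc k) (λ j → c j * Construction.ATab x k j N)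

theorem2 : (k : ℕ) → 1 ≤ k → (c : ℕ → ℤ) → (x : ℤ) → (p : ℕ) → Prime p →
    (m : ℕ) → Σ ℕ (λ N₀ → (N : ℕ) → N₀ ≤ N → (+ (p ^ m)) ∣ (S k c x N - Q k c x))
theorem2 (suc k) _ c x p p-prime m =
  p ^ m , eventually-divisible k c x (ℕP.m^n>0 p m)
  where instance _ = prime⇒nonZero p-prime
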